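{- $\displaystyle\lim_{n\to\infty}\frac{\log \tau(\Gamma_n)}{|V(\Gamma_n)|}=\frac12\log 2$, where $\tau(\Gamma_n)$ is the number of spanning trees of $\Gamma_n$ and $|V(\Gamma_n)|=2^n$.
   Context: Let $X^n$ denote the set of binary words of length $n$ over $\{0,1\}$. The Grigorchuk group is generated by the automorphisms $a,b,c,d$ of the rooted binary tree defined recursively on finite binary words $w$ by $a(0w)=1w$, $a(1w)=0w$, $b(0w)=0a(w)$, $b(1w)=1c(w)$, $c(0w)=0a(w)$, $c(1w)=1d(w)$, $d(0w)=0w$, $d(1w)=1b(w)$; each generator is an involution. For $n\geq1$, the Schreier graph $\Gamma_n$ is the finite multigraph with vertex set $X^n$ having, for each $s\in\{a,b,c,d\}$ and each orbit $\{u,s(u)\}$ of $s$ on $X^n$, one edge joining $u$ and $s(u)$ (a loop when $s(u)=u$). Spanning trees are counted as edge subsets (parallel edges distinct). -}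

module Defs where

open import Data.Bool using (Bool; true; false; not; _∧_; _∨_; T)
open import Data.Nat using (ℕ; zero; suc; _≤_; _<_; _*_; _^_)
open import Data.Fin using (Fin)
open import Data.List using (List; []; _∷_; length; map; concatMap; filterᵇ; _++_)
open import Data.List.Relation.Unary.Unique.Propositional using (Unique)
open import Data.List.Membership.Propositional using (_∈_)
open import Data.Vec using (Vec; []; _∷_; lookup; fromList)
open import Data.Product using (Σ; _×_; _,_; ∃; ∃-syntax)
open import Data.Sum using (_⊎_)
open import Relation.Binary.PropositionalEquality using (_≡_)
open import Relation.Nullary using (¬_)
open import Function.Bundles using (_⇔_)

-- Binary words of length n; false = 0, true = 1 (first letter = head).
Word : ℕ → Set
Word n = Vec Bool n

data Gen : Set where
  a b c d : Gen

act : Gen → {n : ℕ} → Word n → Word n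
act s [] = []
act a (x ∷ w) = not x ∷ w
act b (false ∷ w) = false ∷ act a w
act b (true ∷ w) = true ∷ act c w
act c (false ∷ w) = false ∷ act a w
act c (true ∷ w) = true ∷ act d w
act d (false ∷ w) = false ∷ w
act d (true ∷ w) = true ∷ act b w

allWords : (n : ℕ) → List (Word n)
allWords zero = [] ∷ []
allWords (suc n) = map (false ∷_) (allWords n) ++ map (true ∷_) (allWords n)

leqᵇ : {n : ℕ} → Word n → Word n → Bool
leqᵇ [] [] = true
leqᵇ (false ∷ u) (true ∷ v) = true
leqᵇ (true ∷ u) (false ∷ v) = false
leqᵇ (false ∷ u) (false ∷ v) = leqᵇ u v
leqᵇ (true ∷ u) (true ∷ v) = leqᵇ u v

gens : List Gen
gens = a ∷ b ∷ c ∷ d ∷ []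

-- Edges of Γ_n: for each generator s and each orbit {u, s u} exactly one edge,
-- represented by (s, u) with u the lexicographically smaller element of the orbit.
-- (Since s is an involution this picks one representative per orbit; a fixed
-- point gives a loop.)
edgeList : (n : ℕ) → List (Gen × Word n)
edgeList n = concatMap (λ s → map (s ,_) (filterᵇ (λ u → leqᵇ u (act s u)) (allWords n))) gens

numEdges : ℕ → ℕ
numEdges n = length (edgeList n)

edge : (n : ℕ) → Fin (numEdges n) → Gen × Word n
edge n i = lookup (fromList (edgeList n)) i

Joins : (n : ℕ) → Fin (numEdges n) → Word n → Word n → Set
Joins n i u w with edge n i
... | (s , x) = (u ≡ x × w ≡ act s x) ⊎ (u ≡ act s x × w ≡ x)

-- An edge subset of Γ_n (parallel edges distinct: subsets of edge indices).
EdgeSubset : ℕ → Set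
EdgeSubset n = Vec Bool (numEdges n)

data Walk (n : ℕ) (S : EdgeSubset n) : Word n → Word n → List (Fin (numEdges n)) → Set where
  nil  : ∀ {u} → Walk n S u u []
  cons : ∀ {u w v is} (i : Fin (numEdges n)) → lookup S i ≡ true →
         Joins n i u w → Walk n S w v is → Walk n S u v (i ∷ is)

Connected : (n : ℕ) → EdgeSubset n → Set
Connected n S = ∀ (u v : Word n) → ∃[ is ] Walk n S u v is

-- A cycle: a closed walk with at least one edge and no repeated edge
-- (loops and pairs of parallel edges count as cycles).
HasCycle : (n : ℕ) → EdgeSubset n → Set
HasCycle n S = ∃[ u ] ∃[ i ] ∃[ is ] (Walk n S u u (i ∷ is) × Unique (i ∷ is))

IsSpanningTree : (n : ℕ) → EdgeSubset n → Set
IsSpanningTree n S = Connected n S × ¬ HasCycle n S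

HasCount : {A : Set} → (A → Set) → ℕ → Set
HasCount {A} P k = ∃[ L ] (Unique L × length L ≡ k × (∀ (x : A) → (x ∈ L ⇔ P x)))

SpanningTreeCount : ℕ → ℕ → Set
SpanningTreeCount n k = HasCount (IsSpanningTree n) k

{-# OPTIONS --safe #-}

-- Number the words of length n by `position`, a reflected binary code read from the last
-- letter. Then a joins the positions 2m and 2m + 1, while at every word u one of b, c, d
-- fixes u and the other two both move it to `partner u`; these moves join the positions
-- 2m + 1 and 2m + 2 (and are loops at the two ends). So Γ_n is a path through the 2^n words
-- in which 2^(n−1) single a-edges alternate with 2^(n−1) − 1 double edges, plus loops. A
-- spanning tree consists of all a-edges and exactly one edge of each double edge, and every
-- such choice gives one. Indexing the double edges by the words of length n − 1 other than
-- 1⋯1 yields 2^(2^(n−1) − 1) ≤ τ(Γ_n) ≤ 2^(2^(n−1)), which squeezes τ(Γ_n)^(1/2^n) to √2;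
-- Bernoulli's inequality absorbs the factor 1/2 in the lower bound.

module Submission where

open import Defs
open import Data.Bool using (Bool; true; false; not; _∧_; _xor_)
open import Data.Bool.Properties using (not-involutive; not-injective; not-¬; T?; T-≡)
open import Data.Fin using (Fin; zero; suc)
open import Data.Fin.Properties using (injective⇒≤)
open import Data.List using (List; []; _∷_; map; _++_; length; concatMap; filterᵇ; cartesianProduct)
open import Data.List.Properties using (length-map; length-++)
import Data.List as List
open import Data.List.Membership.Propositional using (_∈_)
open import Data.List.Membership.Propositional.Properties
  using (∈-map⁺; ∈-map⁻; ∈-++⁺ˡ; ∈-++⁺ʳ; ∈-filter⁺; ∈-filter⁻; ∈-concatMap⁺; ∈-concatMap⁻; ∈-lookup; ∈-cartesianProduct⁺)
open import Data.List.Relation.Binary.Disjoint.Propositional using (Disjoint)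
open import Data.List.Relation.Unary.All as All using ([]; _∷_)
open import Data.List.Relation.Unary.All.Properties using (All¬⇒¬Any)
open import Data.List.Relation.Unary.AllPairs using ([]; _∷_)
open import Data.List.Relation.Unary.Any using (here; there; index)
import Data.List.Relation.Unary.Any as Any
open import Data.List.Relation.Unary.Any.Properties using (lookup-index)
open import Data.List.Relation.Unary.Unique.Propositional using (Unique)
open import Data.List.Relation.Unary.Unique.Propositional.Properties using (++⁺; map⁺; filter⁺; cartesianProduct⁺)
open import Data.Product.Properties using (,-injectiveʳ)
open import Data.Empty using (⊥; ⊥-elim)
open import Data.Unit using (⊤; tt)
open import Data.Nat using (ℕ; zero; suc; _+_; _*_; _^_; _≤_; _<_; z≤n; s≤s; ⌊_/2⌋)
open import Data.Nat.Tactic.RingSolver using (solve-∀)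
open import Data.Nat.Properties
open import Data.Product using (Σ; _×_; _,_; ∃-syntax; proj₁; proj₂)
open import Data.Sum using (_⊎_; inj₁; inj₂)
open import Data.Vec using ([]; _∷_; head; fromList)
import Data.Vec as Vec
open import Data.Vec.Properties using (∷-injectiveˡ; ∷-injectiveʳ; lookup∘tabulate; tabulate∘lookup; tabulate-cong)
open import Function using (_∘_; case_of_)
open import Function.Bundles using (Equivalence)
open import Relation.Binary.PropositionalEquality
open import Relation.Nullary using (¬_; yes; no)
open import Relation.Unary using (Decidable)

-- Positions along the path

bit : Bool → ℕ
bit false = 0
bit true  = 1

parity : {n : ℕ} → Word n → Bool
parity []      = false
parity (x ∷ v) = not x xor parity v

position : {n : ℕ} → Word n → ℕ
position []      = 0
position (x ∷ v) = bit (parity (x ∷ v)) + (position v + position v)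

bit-injective : ∀ {i j} → bit i ≡ bit j → i ≡ j
bit-injective {false} {false} _ = refl
bit-injective {true}  {true}  _ = refl

⌊bit+double/2⌋ : ∀ i m → ⌊ bit i + (m + m) /2⌋ ≡ m
⌊bit+double/2⌋ false m = sym (n≡⌊n+n/2⌋ m)
⌊bit+double/2⌋ true  m = sym (n≡⌈n+n/2⌉ m)

bit+double-injective : ∀ {i j m k} → bit i + (m + m) ≡ bit j + (k + k) → i ≡ j × m ≡ k
bit+double-injective {i} {j} {m} {k} e = bit-injective (+-cancelʳ-≡ (k + k) (bit i) (bit j) e′) , m≡k
  where
  m≡k : m ≡ k
  m≡k = trans (sym (⌊bit+double/2⌋ i m)) (trans (cong ⌊_/2⌋ e) (⌊bit+double/2⌋ j k))
  e′ : bit i + (k + k) ≡ bit j + (k + k)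
  e′ = subst (λ z → bit i + (z + z) ≡ bit j + (k + k)) m≡k e

xor-cancelʳ : ∀ x y p → x xor p ≡ y xor p → x ≡ y
xor-cancelʳ false false p _ = refl
xor-cancelʳ true  true  p _ = refl
xor-cancelʳ false true  p e = ⊥-elim (not-¬ refl e)
xor-cancelʳ true  false p e = ⊥-elim (not-¬ refl (sym e))

position-injective : {n : ℕ} {u v : Word n} → position u ≡ position v → u ≡ v
position-injective {u = []} {[]} _ = refl
position-injective {u = x ∷ u} {y ∷ v} e
  with parity≡ , position≡ ← bit+double-injective {parity (x ∷ u)} {parity (y ∷ v)} {position u} {position v} e
  with refl ← position-injective {u = u} {v} position≡
  = cong (_∷ u) (not-injective (xor-cancelʳ (not x) (not y) (parity u) parity≡))

position≡0⇒even : {n : ℕ} (u : Word n) → position u ≡ 0 → parity u ≡ false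
position≡0⇒even [] _ = refl
position≡0⇒even (x ∷ v) e with not x xor parity v
... | false = refl
position≡0⇒even (x ∷ v) () | true

EvenStep OddStep : {n : ℕ} → Word n → Word n → Set
EvenStep u u′ = parity u ≡ false × parity u′ ≡ true × position u′ ≡ suc (position u)
OddStep  u u′ = parity u ≡ true × parity u′ ≡ false × position u′ ≡ suc (position u)

false∷-step : {n : ℕ} (v v′ : Word n) → EvenStep v v′ → OddStep (false ∷ v) (false ∷ v′)
false∷-step v v′ (p , p′ , q) rewrite p | p′ | q = refl , refl , cong suc (+-suc (position v) (position v))

true∷-step : {n : ℕ} (v v′ : Word n) → OddStep v v′ → OddStep (true ∷ v) (true ∷ v′)
true∷-step v v′ (p , p′ , q) rewrite p | p′ | q = refl , refl , cong suc (+-suc (position v) (position v))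

a-step : {n : ℕ} (u : Word (suc n)) → EvenStep u (act a u) ⊎ EvenStep (act a u) u
a-step (true ∷ w) with parity w
... | true  = inj₂ (refl , refl , refl)
... | false = inj₁ (refl , refl , refl)
a-step (false ∷ w) with parity w
... | true  = inj₁ (refl , refl , refl)
... | false = inj₂ (refl , refl , refl)

partner : {n : ℕ} → Word n → Word n
partner []              = []
partner (true ∷ w)      = true ∷ partner w
partner (false ∷ [])    = false ∷ []
partner (false ∷ x ∷ w) = false ∷ not x ∷ w

partner-step : {n : ℕ} (u : Word n) →
  OddStep u (partner u) ⊎ OddStep (partner u) u ⊎ (partner u ≡ u × (position u ≡ 0 ⊎ parity u ≡ true))
partner-step []           = inj₂ (inj₂ (refl , inj₁ refl))
partner-step (false ∷ []) = inj₂ (inj₂ (refl , inj₂ refl))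
partner-step (false ∷ x ∷ w) with a-step (x ∷ w)
... | inj₁ up   = inj₁ (false∷-step (x ∷ w) (not x ∷ w) up)
... | inj₂ down = inj₂ (inj₁ (false∷-step (not x ∷ w) (x ∷ w) down))
partner-step (true ∷ w) with partner-step w
... | inj₁ up                       = inj₁ (true∷-step w (partner w) up)
... | inj₂ (inj₁ down)              = inj₂ (inj₁ (true∷-step (partner w) w down))
... | inj₂ (inj₂ (fixed , inj₁ p)) rewrite fixed | p | position≡0⇒even w p = inj₂ (inj₂ (refl , inj₁ refl))
... | inj₂ (inj₂ (fixed , inj₂ p)) rewrite fixed | p = inj₂ (inj₂ (refl , inj₂ refl))

data BCD : Set where
  B C D : BCD

gen : BCD → Gen
gen B = b
gen C = c
gen D = d

next : BCD → BCD
next B = C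
next C = D
next D = B

data GenView : Gen → Set where
  gen-a   : GenView a
  gen-bcd : (G : BCD) → GenView (gen G)

genView : (s : Gen) → GenView s
genView a = gen-a
genView b = gen-bcd B
genView c = gen-bcd C
genView d = gen-bcd D

BCD-cases : ∀ F G → G ≡ F ⊎ G ≡ next F ⊎ G ≡ next (next F)
BCD-cases B B = inj₁ refl
BCD-cases B C = inj₂ (inj₁ refl)
BCD-cases B D = inj₂ (inj₂ refl)
BCD-cases C B = inj₂ (inj₂ refl)
BCD-cases C C = inj₁ refl
BCD-cases C D = inj₂ (inj₁ refl)
BCD-cases D B = inj₂ (inj₁ refl)
BCD-cases D C = inj₂ (inj₂ refl)
BCD-cases D D = inj₁ refl

next≢next² : ∀ F → gen (next F) ≢ gen (next (next F))
next≢next² B ()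
next≢next² C ()
next≢next² D ()

act-true∷ : {n : ℕ} (G : BCD) (w : Word n) → act (gen (next (next G))) (true ∷ w) ≡ true ∷ act (gen G) w
act-true∷ B w = refl
act-true∷ C w = refl
act-true∷ D w = refl

fixedGen : {n : ℕ} → Word n → BCD
fixedGen []          = D
fixedGen (false ∷ w) = D
fixedGen (true ∷ w)  = next (next (fixedGen w))

act-fixedGen : {n : ℕ} (u : Word n) → act (gen (fixedGen u)) u ≡ u
act-fixedGen []          = refl
act-fixedGen (false ∷ w) = refl
act-fixedGen (true ∷ w)  = trans (act-true∷ (fixedGen w) w) (cong (true ∷_) (act-fixedGen w))

act-next-fixedGen : {n : ℕ} (u : Word n) → act (gen (next (fixedGen u))) u ≡ partner u
act-next-fixedGen []              = refl
act-next-fixedGen (false ∷ [])    = refl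
act-next-fixedGen (false ∷ x ∷ w) = refl
act-next-fixedGen (true ∷ w) =
  trans (act-true∷ (next (fixedGen w)) w) (cong (true ∷_) (act-next-fixedGen w))

act-next²-fixedGen : {n : ℕ} (u : Word n) → act (gen (next (next (fixedGen u)))) u ≡ partner u
act-next²-fixedGen []              = refl
act-next²-fixedGen (false ∷ [])    = refl
act-next²-fixedGen (false ∷ x ∷ w) = refl
act-next²-fixedGen (true ∷ w) =
  trans (act-true∷ (next (next (fixedGen w))) w) (cong (true ∷_) (act-next²-fixedGen w))

fixedGen-partner : {n : ℕ} (u : Word n) → fixedGen (partner u) ≡ fixedGen u
fixedGen-partner []              = refl
fixedGen-partner (false ∷ [])    = refl
fixedGen-partner (false ∷ x ∷ w) = refl
fixedGen-partner (true ∷ w)      = cong (λ G → next (next G)) (fixedGen-partner w)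

act-bcd : {n : ℕ} (G : BCD) (u : Word n) → act (gen G) u ≡ u ⊎ act (gen G) u ≡ partner u
act-bcd G u with BCD-cases (fixedGen u) G
... | inj₁ refl        = inj₁ (act-fixedGen u)
... | inj₂ (inj₁ refl) = inj₂ (act-next-fixedGen u)
... | inj₂ (inj₂ refl) = inj₂ (act-next²-fixedGen u)

act-involutive : {n : ℕ} (s : Gen) (u : Word n) → act s (act s u) ≡ u
act-involutive s []          = refl
act-involutive a (x ∷ w)     = cong (_∷ w) (not-involutive x)
act-involutive b (false ∷ w) = cong (false ∷_) (act-involutive a w)
act-involutive b (true ∷ w)  = cong (true ∷_) (act-involutive c w)
act-involutive c (false ∷ w) = cong (false ∷_) (act-involutive a w)
act-involutive c (true ∷ w)  = cong (true ∷_) (act-involutive d w)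
act-involutive d (false ∷ w) = refl
act-involutive d (true ∷ w)  = cong (true ∷_) (act-involutive b w)

act-a-moves : {n : ℕ} (u : Word (suc n)) → act a u ≢ u
act-a-moves (x ∷ w) e = not-¬ refl (sym (cong head e))

act-a≢partner : {n : ℕ} (u : Word (suc n)) → act a u ≢ partner u
act-a≢partner (true ∷ w)      ()
act-a≢partner (false ∷ [])    ()
act-a≢partner (false ∷ x ∷ w) ()

moving-generator : {n : ℕ} {s : Gen} {x : Word (suc n)} → act s x ≡ partner x → partner x ≢ x →
  s ≡ gen (next (fixedGen x)) ⊎ s ≡ gen (next (next (fixedGen x)))
moving-generator {s = s} {x} e moves with genView s
... | gen-a = ⊥-elim (act-a≢partner x e)
... | gen-bcd G with BCD-cases (fixedGen x) G
...   | inj₁ refl        = ⊥-elim (moves (trans (sym e) (act-fixedGen x)))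
...   | inj₂ (inj₁ refl) = inj₁ refl
...   | inj₂ (inj₂ refl) = inj₂ refl

act≡act-a⇒a : {n : ℕ} {s : Gen} {x : Word (suc n)} → act s x ≡ act a x → s ≡ a
act≡act-a⇒a {s = s} {x} e with genView s
... | gen-a = refl
... | gen-bcd G with act-bcd G x
...   | inj₁ fixes = ⊥-elim (act-a-moves x (trans (sym e) fixes))
...   | inj₂ moves = ⊥-elim (act-a≢partner x (trans (sym e) moves))

module _ {A B : Set} (f : A → List B) where

  tagged : List A → List (A × B)
  tagged = concatMap (λ g → map (g ,_) (f g))

  ∈-tagged⁺ : ∀ {gs g x} → g ∈ gs → x ∈ f g → (g , x) ∈ tagged gs
  ∈-tagged⁺ g∈gs x∈fg = ∈-concatMap⁺ _ (Any.map (λ { refl → ∈-map⁺ (_ ,_) x∈fg }) g∈gs)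

  ∈-tagged⁻ : ∀ gs {g x} → (g , x) ∈ tagged gs → x ∈ f g
  ∈-tagged⁻ gs m with h , m′ ← Any.satisfied (∈-concatMap⁻ _ {xs = gs} m)
                 with x′ , x′∈fh , refl ← ∈-map⁻ (h ,_) m′ = x′∈fh

  tag∈tagged : ∀ gs {v} → v ∈ tagged gs → proj₁ v ∈ gs
  tag∈tagged gs m = Any.map (λ m′ → case ∈-map⁻ _ m′ of λ { (_ , _ , refl) → refl }) (∈-concatMap⁻ _ {xs = gs} m)

  tagged-unique : ∀ {gs} → Unique gs → (∀ g → Unique (f g)) → Unique (tagged gs)
  tagged-unique [] _ = []
  tagged-unique {g ∷ gs} (g∉gs ∷ u) uf = ++⁺ (map⁺ ,-injectiveʳ (uf g)) (tagged-unique u uf) disjoint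
    where
    disjoint : Disjoint (map (g ,_) (f g)) (tagged gs)
    disjoint (p , q) with _ , _ , refl ← ∈-map⁻ (g ,_) p = All¬⇒¬Any g∉gs (tag∈tagged gs q)

lookup-fromList : {A : Set} (xs : List A) (i : Fin (length xs)) → Vec.lookup (fromList xs) i ≡ List.lookup xs i
lookup-fromList (x ∷ xs) zero    = refl
lookup-fromList (x ∷ xs) (suc i) = lookup-fromList xs i

unique⇒lookup-injective : {A : Set} {xs : List A} → Unique xs → ∀ i j → List.lookup xs i ≡ List.lookup xs j → i ≡ j
unique⇒lookup-injective (_ ∷ _) zero zero _ = refl
unique⇒lookup-injective (x∉xs ∷ _) zero (suc j) e = ⊥-elim (All.lookup x∉xs (∈-lookup j) e)
unique⇒lookup-injective (x∉xs ∷ _) (suc i) zero e = ⊥-elim (All.lookup x∉xs (∈-lookup i) (sym e))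
unique⇒lookup-injective (_ ∷ u) (suc i) (suc j) e = cong suc (unique⇒lookup-injective u i j e)

leqᵇ-total : {n : ℕ} (u v : Word n) → leqᵇ u v ≡ false → leqᵇ v u ≡ true
leqᵇ-total []          []          ()
leqᵇ-total (false ∷ u) (true ∷ v)  ()
leqᵇ-total (false ∷ u) (false ∷ v) e  = leqᵇ-total u v e
leqᵇ-total (true ∷ u)  (true ∷ v)  e  = leqᵇ-total u v e
leqᵇ-total (true ∷ u)  (false ∷ v) _  = refl

leqᵇ-antisym : {n : ℕ} {u v : Word n} → leqᵇ u v ≡ true → leqᵇ v u ≡ true → u ≡ v
leqᵇ-antisym {u = []}     {[]}        _ _ = refl
leqᵇ-antisym {u = false ∷ u} {false ∷ v} e f = cong (false ∷_) (leqᵇ-antisym e f)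
leqᵇ-antisym {u = true ∷ u}  {true ∷ v}  e f = cong (true ∷_) (leqᵇ-antisym e f)
leqᵇ-antisym {u = false ∷ u} {true ∷ v}  _ ()
leqᵇ-antisym {u = true ∷ u}  {false ∷ v} () _

∈-allWords : {n : ℕ} (w : Word n) → w ∈ allWords n
∈-allWords []                = here refl
∈-allWords {suc n} (false ∷ w) = ∈-++⁺ˡ (∈-map⁺ (false ∷_) (∈-allWords w))
∈-allWords {suc n} (true ∷ w)  = ∈-++⁺ʳ (map (false ∷_) (allWords n)) (∈-map⁺ (true ∷_) (∈-allWords w))

allWords-unique : (n : ℕ) → Unique (allWords n)
allWords-unique zero    = [] ∷ []
allWords-unique (suc n) =
  ++⁺ (map⁺ ∷-injectiveʳ (allWords-unique n)) (map⁺ ∷-injectiveʳ (allWords-unique n)) disjoint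
  where
  disjoint : Disjoint (map (false ∷_) (allWords n)) (map (true ∷_) (allWords n))
  disjoint (p , q) with _ , _ , refl ← ∈-map⁻ (false ∷_) p with _ , _ , () ← ∈-map⁻ (true ∷_) q

∈-gens : ∀ s → s ∈ gens
∈-gens a = here refl
∈-gens b = there (here refl)
∈-gens c = there (there (here refl))
∈-gens d = there (there (there (here refl)))

gens-unique : Unique gens
gens-unique = ((λ ()) ∷ (λ ()) ∷ (λ ()) ∷ []) ∷ ((λ ()) ∷ (λ ()) ∷ []) ∷ ((λ ()) ∷ []) ∷ [] ∷ []

-- By definition, edgeList n ≡ tagged (orientedWords n) gens.
orientedWords : (n : ℕ) → Gen → List (Word n)
orientedWords n s = filterᵇ (λ u → leqᵇ u (act s u)) (allWords n)

∈-edgeList⁺ : {n : ℕ} {s : Gen} {x : Word n} → leqᵇ x (act s x) ≡ true → (s , x) ∈ edgeList n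
∈-edgeList⁺ {n} {s} {x} o =
  ∈-tagged⁺ (orientedWords n) (∈-gens s) (∈-filter⁺ (T? ∘ λ u → leqᵇ u (act s u)) (∈-allWords x) (Equivalence.from T-≡ o))

∈-edgeList⁻ : {n : ℕ} {s : Gen} {x : Word n} → (s , x) ∈ edgeList n → leqᵇ x (act s x) ≡ true
∈-edgeList⁻ {n} {s} m =
  Equivalence.to T-≡ (proj₂ (∈-filter⁻ (T? ∘ λ u → leqᵇ u (act s u)) {xs = allWords n} (∈-tagged⁻ (orientedWords n) gens m)))

edgeList-unique : (n : ℕ) → Unique (edgeList n)
edgeList-unique n = tagged-unique (orientedWords n) gens-unique
  (λ s → filter⁺ (T? ∘ λ u → leqᵇ u (act s u)) (allWords-unique n))

edge∈edgeList : (n : ℕ) (i : Fin (numEdges n)) → edge n i ∈ edgeList n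
edge∈edgeList n i rewrite lookup-fromList (edgeList n) i = ∈-lookup i

edge-oriented : ∀ {n i s x} → edge n i ≡ (s , x) → leqᵇ x (act s x) ≡ true
edge-oriented {n} {i} e = ∈-edgeList⁻ {n} (subst (_∈ edgeList n) e (edge∈edgeList n i))

edge-injective : (n : ℕ) {i j : Fin (numEdges n)} → edge n i ≡ edge n j → i ≡ j
edge-injective n {i} {j} e = unique⇒lookup-injective (edgeList-unique n) i j
  (trans (sym (lookup-fromList (edgeList n) i)) (trans e (lookup-fromList (edgeList n) j)))

edgeIndex : {n : ℕ} (s : Gen) (x : Word n) → leqᵇ x (act s x) ≡ true → Σ (Fin (numEdges n)) λ i → edge n i ≡ (s , x)
edgeIndex {n} s x o = index m , trans (lookup-fromList (edgeList n) (index m)) (sym (lookup-index m))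
  where m = ∈-edgeList⁺ o

joins⁻ : ∀ {n i s x u w} → edge n i ≡ (s , x) → Joins n i u w → (u ≡ x × w ≡ act s x) ⊎ (u ≡ act s x × w ≡ x)
joins⁻ {n} {i} e J with edge n i
joins⁻ refl J | _ = J

joins⁺ : ∀ {n i s x} → edge n i ≡ (s , x) → Joins n i x (act s x)
joins⁺ {n} {i} e with edge n i
joins⁺ refl | _ = inj₁ (refl , refl)

joins-sym : ∀ {n i u w} → Joins n i u w → Joins n i w u
joins-sym {n} {i} J with edge n i
... | _ with J
...   | inj₁ (p , q) = inj₂ (q , p)
...   | inj₂ (p , q) = inj₁ (q , p)

joins-oriented : ∀ {n j s x u w} → edge n j ≡ (s , x) → Joins n j u w → leqᵇ u w ≡ true → u ≢ w →
  x ≡ u × act s x ≡ w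
joins-oriented e J u≤w u≢w with joins⁻ e J
... | inj₁ (refl , refl) = refl , refl
... | inj₂ (refl , refl) = ⊥-elim (u≢w (leqᵇ-antisym u≤w (edge-oriented e)))

oriented-at-image : {n : ℕ} (s : Gen) (u : Word n) → leqᵇ u (act s u) ≡ false → leqᵇ (act s u) (act s (act s u)) ≡ true
oriented-at-image s u u≰su rewrite act-involutive s u = leqᵇ-total u (act s u) u≰su

edge-between : {n : ℕ} (s : Gen) (u : Word n) →
  Σ (Fin (numEdges n)) λ i → (edge n i ≡ (s , u) ⊎ edge n i ≡ (s , act s u)) × Joins n i u (act s u)
edge-between s u with leqᵇ u (act s u) in u≤su
... | true with i , e ← edgeIndex s u u≤su = i , inj₁ e , joins⁺ e
... | false with i , e ← edgeIndex s (act s u) (oriented-at-image s u u≤su)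
  = i , inj₂ e , subst (λ z → Joins _ i z (act s u)) (act-involutive s u) (joins-sym (joins⁺ e))

-- Walks and connectivity

_++ʷ_ : ∀ {n S u v w is js} → Walk n S u v is → Walk n S v w js → Walk n S u w (is ++ js)
nil            ++ʷ q = q
cons i Si J p ++ʷ q = cons i Si J (p ++ʷ q)

reverseʷ : ∀ {n S u v is} → Walk n S u v is → ∃[ js ] Walk n S v u js
reverseʷ nil = [] , nil
reverseʷ (cons i Si J p) with js , q ← reverseʷ p = js ++ i ∷ [] , q ++ʷ cons i Si (joins-sym J) nil

crossing : ∀ {n S u v is} (P : Word n → Set) → Decidable P → Walk n S u v is → P u → ¬ P v →
  ∃[ j ] ∃[ x ] ∃[ y ] (j ∈ is × Vec.lookup S j ≡ true × Joins n j x y × P x × ¬ P y)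
crossing P P? nil Pu ¬Pv = ⊥-elim (¬Pv Pu)
crossing P P? (cons {w = w} i Si J p) Pu ¬Pv with P? w
... | no ¬Pw = i , _ , w , here refl , Si , J , Pu , ¬Pw
... | yes Pw with j , x , y , j∈is , rest ← crossing P P? p Pw ¬Pv = j , x , y , there j∈is , rest

Adjacent : ℕ → ℕ → Set
Adjacent m k = m ≡ k ⊎ k ≡ suc m ⊎ m ≡ suc k

adjacent-sym : ∀ {m k} → Adjacent m k → Adjacent k m
adjacent-sym (inj₁ e)        = inj₁ (sym e)
adjacent-sym (inj₂ (inj₁ e)) = inj₂ (inj₂ e)
adjacent-sym (inj₂ (inj₂ e)) = inj₂ (inj₁ e)

adjacent-straddle : ∀ {m k p} → Adjacent m k → m ≤ p → p < k → m ≡ p × k ≡ suc p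
adjacent-straddle (inj₁ refl)        m≤p p<m   = ⊥-elim (≤⇒≯ m≤p p<m)
adjacent-straddle (inj₂ (inj₁ refl)) m≤p p<1+m = m≡p , cong suc m≡p
  where m≡p = ≤-antisym m≤p (≤-pred p<1+m)
adjacent-straddle (inj₂ (inj₂ refl)) 1+k≤p p<k = ⊥-elim (≤⇒≯ (≤-trans (n≤1+n _) 1+k≤p) p<k)

partner-adjacent : {n : ℕ} (x : Word n) → Adjacent (position x) (position (partner x))
partner-adjacent x with partner-step x
... | inj₁ (_ , _ , up)        = inj₂ (inj₁ up)
... | inj₂ (inj₁ (_ , _ , dn)) = inj₂ (inj₂ dn)
... | inj₂ (inj₂ (fixed , _))  = inj₁ (cong position (sym fixed))

act-adjacent : {n : ℕ} (s : Gen) (x : Word n) → Adjacent (position x) (position (act s x))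
act-adjacent s x with genView s
act-adjacent s [] | gen-a = inj₁ refl
act-adjacent s (y ∷ x) | gen-a with a-step (y ∷ x)
... | inj₁ (_ , _ , up) = inj₂ (inj₁ up)
... | inj₂ (_ , _ , dn) = inj₂ (inj₂ dn)
act-adjacent s x | gen-bcd G with act-bcd G x
... | inj₁ fixes = inj₁ (cong position (sym fixes))
... | inj₂ moves rewrite moves = partner-adjacent x

joins-adjacent : ∀ {n i u w} → Joins n i u w → Adjacent (position u) (position w)
joins-adjacent {n} {i} J with joins⁻ {s = proj₁ (edge n i)} {x = proj₂ (edge n i)} refl J
... | inj₁ (refl , refl) = act-adjacent (proj₁ (edge n i)) (proj₂ (edge n i))
... | inj₂ (refl , refl) = adjacent-sym (act-adjacent (proj₁ (edge n i)) (proj₂ (edge n i)))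

CrossingEdge : (n : ℕ) → EdgeSubset n → List (Fin (numEdges n)) → ℕ → Set
CrossingEdge n S is p = ∃[ j ] ∃[ x ] ∃[ y ]
  (j ∈ is × Vec.lookup S j ≡ true × Joins n j x y × position x ≡ p × position y ≡ suc p)

walk-crosses-up : ∀ {n S u v is} p → Walk n S u v is → position u ≤ p → p < position v → CrossingEdge n S is p
walk-crosses-up p walk u≤p p<v
  with j , x , y , j∈is , Sj , J , x≤p , y≰p ← crossing (λ z → position z ≤ p) (λ z → position z ≤? p) walk u≤p (<⇒≱ p<v)
  with x≡p , y≡1+p ← adjacent-straddle (joins-adjacent J) x≤p (≰⇒> y≰p)
  = j , x , y , j∈is , Sj , J , x≡p , y≡1+p

walk-crosses-down : ∀ {n S u v is} p → Walk n S u v is → p < position u → position v ≤ p → CrossingEdge n S is p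
walk-crosses-down p walk p<u v≤p
  with j , x , y , j∈is , Sj , J , p<x , p≮y ← crossing (λ z → p < position z) (λ z → p <? position z) walk p<u (≤⇒≯ v≤p)
  with y≡p , x≡1+p ← adjacent-straddle (adjacent-sym (joins-adjacent J)) (≮⇒≥ p≮y) p<x
  = j , y , x , j∈is , Sj , joins-sym J , y≡p , x≡1+p

connected⇒edge-to-successor : ∀ {n S} → Connected n S → {x y : Word n} → position y ≡ suc (position x) →
  Σ (Fin (numEdges n)) λ j → Vec.lookup S j ≡ true × Joins n j x y
connected⇒edge-to-successor conn {x} {y} y≡ with _ , walk ← conn x y
  with j , x′ , y′ , _ , Sj , J , x′≡ , y′≡ ← walk-crosses-up (position x) walk ≤-refl (≤-reflexive (sym y≡))
  with refl ← position-injective {u = x′} {x} x′≡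
  with refl ← position-injective {u = y′} {y} (trans y′≡ (sym y≡))
  = j , Sj , J

connected⇒edge-between : ∀ {n S} → Connected n S → {x y : Word n} → x ≢ y → Adjacent (position x) (position y) →
  Σ (Fin (numEdges n)) λ j → Vec.lookup S j ≡ true × Joins n j x y
connected⇒edge-between conn x≢y (inj₁ x≡y)        = ⊥-elim (x≢y (position-injective x≡y))
connected⇒edge-between conn x≢y (inj₂ (inj₁ up))   = connected⇒edge-to-successor conn up
connected⇒edge-between conn x≢y (inj₂ (inj₂ down)) with j , Sj , J ← connected⇒edge-to-successor conn down
  = j , Sj , joins-sym J

module _ {n : ℕ} {S : EdgeSubset n}
  (loopless : ∀ {i u} → Vec.lookup S i ≡ true → ¬ Joins n i u u)
  (simple : ∀ {i j u w} → Vec.lookup S i ≡ true → Vec.lookup S j ≡ true → Joins n i u w → Joins n j u w → i ≡ j)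
  where

  no-parallel-crossing : ∀ {i is u w p} → Vec.lookup S i ≡ true → Joins n i u w → All.All (i ≢_) is →
    position u ≡ p → position w ≡ suc p → ¬ CrossingEdge n S is p
  no-parallel-crossing {u = u} {w} Si J i∉is u≡p w≡1+p (j , x , y , j∈is , Sj , J′ , x≡p , y≡1+p)
    with refl ← position-injective {u = x} {u} (trans x≡p (sym u≡p))
    with refl ← position-injective {u = y} {w} (trans y≡1+p (sym w≡1+p))
    = All.lookup i∉is j∈is (simple Si Sj J J′)

  loopless+simple⇒acyclic : ¬ HasCycle n S
  loopless+simple⇒acyclic (u , i , is , cons {w = w} _ Si J rest , i∉is ∷ _) with joins-adjacent J
  ... | inj₁ u≡w with refl ← position-injective {u = u} {w} u≡w = loopless Si J
  ... | inj₂ (inj₁ w≡1+u) = no-parallel-crossing Si J i∉is refl w≡1+u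
    (walk-crosses-down (position u) rest (≤-reflexive (sym w≡1+u)) ≤-refl)
  ... | inj₂ (inj₂ u≡1+w) = no-parallel-crossing Si (joins-sym J) i∉is refl u≡1+w
    (walk-crosses-up (position w) rest ≤-refl (≤-reflexive (sym u≡1+w)))

origin : (n : ℕ) → Word n
origin zero    = []
origin (suc n) = true ∷ origin n

position-origin : (n : ℕ) → position (origin n) ≡ 0
position-origin zero = refl
position-origin (suc n) rewrite position≡0⇒even (origin n) (position-origin n) | position-origin n = refl

StepsDown : (n : ℕ) → EdgeSubset n → Set
StepsDown n S = ∀ {p} (u : Word n) → position u ≡ suc p →
  ∃[ j ] ∃[ u′ ] (Vec.lookup S j ≡ true × Joins n j u u′ × position u′ ≡ p)

walk-to-origin : ∀ {n S} → StepsDown n S → ∀ p (u : Word n) → position u ≡ p → ∃[ is ] (Walk n S u (origin n) is)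
walk-to-origin {n} down zero u e with refl ← position-injective {u = u} {origin n} (trans e (sym (position-origin n))) = [] , nil
walk-to-origin down (suc p) u e
  with j , u′ , Sj , J , e′ ← down u e
  with is , walk ← walk-to-origin down p u′ e′
  = j ∷ is , cons j Sj J walk

stepsDown⇒connected : ∀ {n S} → StepsDown n S → Connected n S
stepsDown⇒connected down u v
  with is , p ← walk-to-origin down _ u refl
  with js , q ← walk-to-origin down _ v refl
  with ks , q′ ← reverseʷ q
  = is ++ ks , p ++ʷ q′

-- The spanning trees

doubled : {n : ℕ} → Word n → Bool
doubled []              = false
doubled (true ∷ w)      = doubled w
doubled (false ∷ [])    = false
doubled (false ∷ _ ∷ _) = true

doubled⇒partner≢ : {n : ℕ} (x : Word n) → doubled x ≡ true → partner x ≢ x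
doubled⇒partner≢ (true ∷ w)      dx e = doubled⇒partner≢ w dx (∷-injectiveʳ e)
doubled⇒partner≢ (false ∷ y ∷ w) _ e = not-¬ refl (sym (∷-injectiveˡ (∷-injectiveʳ e)))

¬doubled⇒partner≡ : {n : ℕ} (x : Word n) → doubled x ≡ false → partner x ≡ x
¬doubled⇒partner≡ []           _ = refl
¬doubled⇒partner≡ (true ∷ w)   dx = cong (true ∷_) (¬doubled⇒partner≡ w dx)
¬doubled⇒partner≡ (false ∷ []) _ = refl

partner≢⇒doubled : {n : ℕ} (x : Word n) → partner x ≢ x → doubled x ≡ true
partner≢⇒doubled x moves with doubled x in dx
... | true  = refl
... | false = ⊥-elim (moves (¬doubled⇒partner≡ x dx))

doubled-partner : {n : ℕ} (x : Word n) → doubled (partner x) ≡ doubled x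
doubled-partner []              = refl
doubled-partner (true ∷ w)      = doubled-partner w
doubled-partner (false ∷ [])    = refl
doubled-partner (false ∷ y ∷ w) = refl

-- The two ends of a double edge differ exactly in the letter after the first 0: pairIndex
-- deletes that letter, and pairRep reinserts it as 0, which gives the lexicographically
-- smaller end.
pairIndex : {k : ℕ} → Word (suc k) → Word k
pairIndex {zero}  _               = []
pairIndex {suc k} (true ∷ w)      = true ∷ pairIndex w
pairIndex {suc k} (false ∷ _ ∷ w) = false ∷ w

pairRep : {k : ℕ} → Word k → Word (suc k)
pairRep []          = true ∷ []
pairRep (true ∷ y)  = true ∷ pairRep y
pairRep (false ∷ y) = false ∷ false ∷ y

pairIndex-partner : {k : ℕ} (x : Word (suc k)) → pairIndex (partner x) ≡ pairIndex x
pairIndex-partner {zero}  x               = refl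
pairIndex-partner {suc k} (true ∷ w)      = cong (true ∷_) (pairIndex-partner w)
pairIndex-partner {suc k} (false ∷ y ∷ w) = refl

pairIndex-pairRep : {k : ℕ} (y : Word k) → pairIndex (pairRep y) ≡ y
pairIndex-pairRep []          = refl
pairIndex-pairRep (true ∷ y)  = cong (true ∷_) (pairIndex-pairRep y)
pairIndex-pairRep (false ∷ y) = refl

pairRep-pairIndex : {k : ℕ} (x : Word (suc k)) → doubled x ≡ true → leqᵇ x (partner x) ≡ true → pairRep (pairIndex x) ≡ x
pairRep-pairIndex {suc k} (true ∷ w)           dx o = cong (true ∷_) (pairRep-pairIndex w dx o)
pairRep-pairIndex {suc k} (false ∷ false ∷ w)  _ _ = refl
pairRep-pairIndex {zero}  (true ∷ [])          () _
pairRep-pairIndex {zero}  (false ∷ [])         () _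

pairRep-oriented : {k : ℕ} (y : Word k) → leqᵇ (pairRep y) (partner (pairRep y)) ≡ true
pairRep-oriented []          = refl
pairRep-oriented (true ∷ y)  = pairRep-oriented y
pairRep-oriented (false ∷ y) = refl

pairRep-doubled : {k : ℕ} (y : Word k) → y ≢ origin k → doubled (pairRep y) ≡ true
pairRep-doubled []          y≢o = ⊥-elim (y≢o refl)
pairRep-doubled (true ∷ y)  y≢o = pairRep-doubled y (y≢o ∘ cong (true ∷_))
pairRep-doubled (false ∷ y) _   = refl

-- On the double edge at x, whose ends are fixed by F = fixedGen x, a choice keeps the edge
-- labelled next F (value true) or the one labelled next (next F) (value false).
chosen : BCD → Bool → BCD
chosen F true  = next F
chosen F false = next (next F)

_==_ : BCD → BCD → Bool
B == B = true
C == C = true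
D == D = true
_ == _ = false

==⇒≡ : ∀ {G H} → (G == H) ≡ true → G ≡ H
==⇒≡ {B} {B} _ = refl
==⇒≡ {C} {C} _ = refl
==⇒≡ {D} {D} _ = refl
==⇒≡ {B} {C} ()
==⇒≡ {B} {D} ()
==⇒≡ {C} {B} ()
==⇒≡ {C} {D} ()
==⇒≡ {D} {B} ()
==⇒≡ {D} {C} ()

==-refl : ∀ G → (G == G) ≡ true
==-refl B = refl
==-refl C = refl
==-refl D = refl

self==chosen : ∀ F v → (F == chosen F v) ≡ false
self==chosen B true  = refl
self==chosen C true  = refl
self==chosen D true  = refl
self==chosen B false = refl
self==chosen C false = refl
self==chosen D false = refl

next==chosen : ∀ F v → (next F == chosen F v) ≡ v
next==chosen B true  = refl
next==chosen C true  = refl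
next==chosen D true  = refl
next==chosen B false = refl
next==chosen C false = refl
next==chosen D false = refl

next²==chosen : ∀ F v → (next (next F) == chosen F v) ≡ not v
next²==chosen B true  = refl
next²==chosen C true  = refl
next²==chosen D true  = refl
next²==chosen B false = refl
next²==chosen C false = refl
next²==chosen D false = refl

act-chosen : {n : ℕ} (x : Word n) (v : Bool) → act (gen (chosen (fixedGen x) v)) x ≡ partner x
act-chosen x true  = act-next-fixedGen x
act-chosen x false = act-next²-fixedGen x

Choice : ℕ → Set
Choice k = Word k → Bool

selects : {k : ℕ} → Choice k → BCD → Word (suc k) → Bool
selects χ G x = doubled x ∧ (G == chosen (fixedGen x) (χ (pairIndex x)))

inTree : {k : ℕ} → Choice k → Gen → Word (suc k) → Bool
inTree χ a x = true
inTree χ b x = selects χ B x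
inTree χ c x = selects χ C x
inTree χ d x = selects χ D x

tree : (k : ℕ) → Choice k → EdgeSubset (suc k)
tree k χ = Vec.tabulate λ i → inTree χ (proj₁ (edge (suc k) i)) (proj₂ (edge (suc k) i))

inTree-gen : {k : ℕ} (χ : Choice k) (G : BCD) (x : Word (suc k)) → inTree χ (gen G) x ≡ selects χ G x
inTree-gen χ B x = refl
inTree-gen χ C x = refl
inTree-gen χ D x = refl

lookup-tree : ∀ {k} (χ : Choice k) {i s x} → edge (suc k) i ≡ (s , x) → Vec.lookup (tree k χ) i ≡ inTree χ s x
lookup-tree {k} χ {i} e = trans (lookup∘tabulate _ i) (cong (λ (s , x) → inTree χ s x) e)

selects⇒chosen : ∀ {k} (χ : Choice k) {G : BCD} (x : Word (suc k)) → selects χ G x ≡ true →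
  doubled x ≡ true × G ≡ chosen (fixedGen x) (χ (pairIndex x))
selects⇒chosen χ x sel with doubled x
... | true = refl , ==⇒≡ sel

selects-chosen : ∀ {k} (χ : Choice k) (x : Word (suc k)) → doubled x ≡ true →
  selects χ (chosen (fixedGen x) (χ (pairIndex x))) x ≡ true
selects-chosen χ x dx rewrite dx = ==-refl _

selects-partner : ∀ {k} (χ : Choice k) (G : BCD) (x : Word (suc k)) → selects χ G (partner x) ≡ selects χ G x
selects-partner χ G x rewrite doubled-partner x | fixedGen-partner x | pairIndex-partner x = refl

inTree⇒moves : ∀ {k} (χ : Choice k) (s : Gen) (x : Word (suc k)) → inTree χ s x ≡ true → act s x ≢ x
inTree⇒moves χ s x T with genView s
... | gen-a = act-a-moves x
... | gen-bcd G with dx , refl ← selects⇒chosen χ x (trans (sym (inTree-gen χ G x)) T)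
  = λ fixes → doubled⇒partner≢ x dx (trans (sym (act-chosen x (χ (pairIndex x)))) fixes)

inTree-functional : ∀ {k} (χ : Choice k) {s s′ : Gen} (x : Word (suc k)) → inTree χ s x ≡ true → inTree χ s′ x ≡ true →
  act s x ≡ act s′ x → s ≡ s′
inTree-functional χ {s} {s′} x T T′ e with genView s | genView s′
... | gen-a     | gen-a      = refl
... | gen-a     | gen-bcd G′ with _ , refl ← selects⇒chosen χ x (trans (sym (inTree-gen χ G′ x)) T′)
  = ⊥-elim (act-a≢partner x (trans e (act-chosen x (χ (pairIndex x)))))
... | gen-bcd G | gen-a      with _ , refl ← selects⇒chosen χ x (trans (sym (inTree-gen χ G x)) T)
  = ⊥-elim (act-a≢partner x (trans (sym e) (act-chosen x (χ (pairIndex x)))))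
... | gen-bcd G | gen-bcd G′
  with _ , refl ← selects⇒chosen χ x (trans (sym (inTree-gen χ G x)) T)
  with _ , refl ← selects⇒chosen χ x (trans (sym (inTree-gen χ G′ x)) T′) = refl

inTree-act : ∀ {k} (χ : Choice k) (s : Gen) (x : Word (suc k)) → inTree χ s (act s x) ≡ inTree χ s x
inTree-act χ s x with genView s
... | gen-a = refl
... | gen-bcd G rewrite inTree-gen χ G (act (gen G) x) | inTree-gen χ G x with act-bcd G x
...   | inj₁ fixes = cong (selects χ G) fixes
...   | inj₂ moves rewrite moves = selects-partner χ G x

inTree-cong : ∀ {k} {χ χ′ : Choice k} → (∀ y → χ y ≡ χ′ y) → ∀ s x → inTree χ s x ≡ inTree χ′ s x
inTree-cong {χ = χ} {χ′} h s x with genView s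
... | gen-a = refl
... | gen-bcd G rewrite inTree-gen χ G x | inTree-gen χ′ G x =
  cong (λ v → doubled x ∧ (G == chosen (fixedGen x) v)) (h (pairIndex x))

tree-cong : ∀ {k} {χ χ′ : Choice k} → (∀ y → χ y ≡ χ′ y) → tree k χ ≡ tree k χ′
tree-cong {k} h = tabulate-cong λ i → inTree-cong h (proj₁ (edge (suc k) i)) (proj₂ (edge (suc k) i))

module _ {k : ℕ} (χ : Choice k) where

  private
    n = suc k

  tree-loopless : ∀ {i u} → Vec.lookup (tree k χ) i ≡ true → ¬ Joins n i u u
  tree-loopless {i} T J = inTree⇒moves χ s x (trans (sym (lookup-tree χ refl)) T) (loop (joins⁻ refl J))
    where
    s = proj₁ (edge n i)
    x = proj₂ (edge n i)
    loop : ∀ {u} → (u ≡ x × u ≡ act s x) ⊎ (u ≡ act s x × u ≡ x) → act s x ≡ x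
    loop (inj₁ (refl , e)) = sym e
    loop (inj₂ (e , refl)) = sym e

  tree-simple-oriented : ∀ {i j u w} → Vec.lookup (tree k χ) i ≡ true → Vec.lookup (tree k χ) j ≡ true →
    Joins n i u w → Joins n j u w → leqᵇ u w ≡ true → u ≢ w → i ≡ j
  tree-simple-oriented {i} {j} {u} Ti Tj Ji Jj u≤w u≢w
    with xi≡u , si≡w ← joins-oriented refl Ji u≤w u≢w
    with xj≡u , sj≡w ← joins-oriented refl Jj u≤w u≢w
    = edge-injective n (cong₂ _,_ si≡sj (trans xi≡u (sym xj≡u)))
    where
    at-u : ∀ {j} → Vec.lookup (tree k χ) j ≡ true → proj₂ (edge n j) ≡ u → inTree χ (proj₁ (edge n j)) u ≡ true
    at-u {j} T x≡u = subst (λ z → inTree χ (proj₁ (edge n j)) z ≡ true) x≡u (trans (sym (lookup-tree χ refl)) T)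
    si≡sj : proj₁ (edge n i) ≡ proj₁ (edge n j)
    si≡sj = inTree-functional χ u (at-u Ti xi≡u) (at-u Tj xj≡u)
      (trans (cong (act _) (sym xi≡u)) (trans si≡w (trans (sym sj≡w) (cong (act _) xj≡u))))

  tree-simple : ∀ {i j u w} → Vec.lookup (tree k χ) i ≡ true → Vec.lookup (tree k χ) j ≡ true →
    Joins n i u w → Joins n j u w → i ≡ j
  tree-simple {u = u} {w} Ti Tj Ji Jj with leqᵇ u w in u≤w
  ... | true  = tree-simple-oriented Ti Tj Ji Jj u≤w λ { refl → tree-loopless Ti Ji }
  ... | false = tree-simple-oriented Ti Tj (joins-sym Ji) (joins-sym Jj) (leqᵇ-total u w u≤w) λ { refl → tree-loopless Ti Ji }

  tree-step : ∀ {p} (s : Gen) (u : Word n) → inTree χ s u ≡ true → position (act s u) ≡ p →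
    ∃[ j ] ∃[ u′ ] (Vec.lookup (tree k χ) j ≡ true × Joins n j u u′ × position u′ ≡ p)
  tree-step s u T su≡p with i , e , J ← edge-between s u = i , act s u , present e , J , su≡p
    where
    present : edge n i ≡ (s , u) ⊎ edge n i ≡ (s , act s u) → Vec.lookup (tree k χ) i ≡ true
    present (inj₁ e) = trans (lookup-tree χ e) T
    present (inj₂ e) = trans (lookup-tree χ e) (trans (inTree-act χ s u) T)

  tree-stepsDown : StepsDown n (tree k χ)
  tree-stepsDown {p} u u≡1+p with a-step u
  ... | inj₂ (_ , _ , a-down) = tree-step a u refl (suc-injective (trans (sym a-down) u≡1+p))
  ... | inj₁ (u-even , _ , _) with partner-step u
  ...   | inj₁ (u-odd , _)             with () ← trans (sym u-odd) u-even
  ...   | inj₂ (inj₂ (_ , inj₂ u-odd)) with () ← trans (sym u-odd) u-even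
  ...   | inj₂ (inj₂ (_ , inj₁ u≡0))   with () ← trans (sym u≡0) u≡1+p
  ...   | inj₂ (inj₁ (_ , _ , partner-down)) =
    tree-step (gen G) u (trans (inTree-gen χ G u) (selects-chosen χ u (partner≢⇒doubled u moves)))
      (trans (cong position (act-chosen u (χ (pairIndex u)))) (suc-injective (trans (sym partner-down) u≡1+p)))
    where
    G = chosen (fixedGen u) (χ (pairIndex u))
    moves : partner u ≢ u
    moves fixed = 1+n≢n (sym (subst (λ z → position u ≡ suc (position z)) fixed partner-down))

  tree-spanning : IsSpanningTree n (tree k χ)
  tree-spanning = stepsDown⇒connected tree-stepsDown , loopless+simple⇒acyclic tree-loopless tree-simple

-- Every spanning tree is one of them

exactly-one : ∀ {p q} → p ≡ true ⊎ q ≡ true → ¬ (p ≡ true × q ≡ true) → q ≡ not p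
exactly-one {true}  {true}  _ both = ⊥-elim (both (refl , refl))
exactly-one {true}  {false} _ _    = refl
exactly-one {false} {true}  _ _    = refl
exactly-one {false} {false} (inj₁ ()) _
exactly-one {false} {false} (inj₂ ()) _

oriented-partner : ∀ {n i G x} → edge n i ≡ (gen G , x) → act (gen G) x ≡ partner x → leqᵇ x (partner x) ≡ true
oriented-partner {x = x} e moves = subst (λ z → leqᵇ x z ≡ true) moves (edge-oriented e)

pairEdge : {k : ℕ} (y : Word k) →
  Σ (Fin (numEdges (suc k))) λ i → edge (suc k) i ≡ (gen (next (fixedGen (pairRep y))) , pairRep y)
pairEdge y = edgeIndex _ (pairRep y)
  (subst (λ z → leqᵇ (pairRep y) z ≡ true) (sym (act-next-fixedGen (pairRep y))) (pairRep-oriented y))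

choiceOf : {k : ℕ} → EdgeSubset (suc k) → Choice k
choiceOf S y = Vec.lookup S (proj₁ (pairEdge y))

choiceOf-tree : ∀ {k} (χ : Choice k) (y : Word k) → y ≢ origin k → choiceOf (tree k χ) y ≡ χ y
choiceOf-tree χ y y≢o = begin
  choiceOf (tree _ χ) y                               ≡⟨ lookup-tree χ (proj₂ (pairEdge y)) ⟩
  inTree χ (gen (next F)) x                            ≡⟨ inTree-gen χ (next F) x ⟩
  doubled x ∧ (next F == chosen F (χ (pairIndex x)))   ≡⟨ cong (_∧ (next F == chosen F (χ (pairIndex x)))) (pairRep-doubled y y≢o) ⟩
  next F == chosen F (χ (pairIndex x))                 ≡⟨ next==chosen F _ ⟩
  χ (pairIndex x)                                      ≡⟨ cong χ (pairIndex-pairRep y) ⟩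
  χ y                                                  ∎
  where
  open ≡-Reasoning
  x = pairRep y
  F = fixedGen x

choiceOf-pairIndex : ∀ {k} (S : EdgeSubset (suc k)) {i x} → edge (suc k) i ≡ (gen (next (fixedGen x)) , x) →
  doubled x ≡ true → leqᵇ x (partner x) ≡ true → choiceOf S (pairIndex x) ≡ Vec.lookup S i
choiceOf-pairIndex S {i} {x} e dx x≤px = cong (Vec.lookup S) (edge-injective _ (begin
  edge _ (proj₁ (pairEdge (pairIndex x)))         ≡⟨ proj₂ (pairEdge (pairIndex x)) ⟩
  (gen (next (fixedGen x′)) , x′)                 ≡⟨ cong (λ z → gen (next (fixedGen z)) , z) (pairRep-pairIndex x dx x≤px) ⟩
  (gen (next (fixedGen x)) , x)                   ≡⟨ sym e ⟩
  edge _ i                                        ∎))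
  where
  open ≡-Reasoning
  x′ = pairRep (pairIndex x)

module _ {k : ℕ} {S : EdgeSubset (suc k)} (spanning : IsSpanningTree (suc k) S) where

  private
    n = suc k
    connected = proj₁ spanning
    acyclic   = proj₂ spanning

  loop∉spanning : ∀ {i s x} → edge n i ≡ (s , x) → act s x ≡ x → Vec.lookup S i ≡ false
  loop∉spanning {i} {s} {x} e fixes with Vec.lookup S i in Si
  ... | false = refl
  ... | true  = ⊥-elim (acyclic (x , i , [] , cons i Si (subst (Joins n i x) fixes (joins⁺ e)) nil , [] ∷ []))

  spanning-edge-at : ∀ (s : Gen) (x : Word n) → act s x ≢ x → leqᵇ x (act s x) ≡ true →
    ∃[ j ] ∃[ s′ ] (Vec.lookup S j ≡ true × edge n j ≡ (s′ , x) × act s′ x ≡ act s x)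
  spanning-edge-at s x moves x≤sx
    with j , Sj , J ← connected⇒edge-between connected (moves ∘ sym) (act-adjacent s x)
    with x′≡x , s′x′≡sx ← joins-oriented refl J x≤sx (moves ∘ sym)
    = j , proj₁ (edge n j) , Sj , cong (proj₁ (edge n j) ,_) x′≡x , trans (cong (act _) (sym x′≡x)) s′x′≡sx

  a-edge∈spanning : ∀ {i x} → edge n i ≡ (a , x) → Vec.lookup S i ≡ true
  a-edge∈spanning {i} {x} e
    with j , s′ , Sj , ej , s′x≡ax ← spanning-edge-at a x (act-a-moves x) (edge-oriented e)
    with refl ← act≡act-a⇒a {s = s′} s′x≡ax
    = subst (λ z → Vec.lookup S z ≡ true) (edge-injective n (trans ej (sym e))) Sj

  pair-exclusive : ∀ {i₁ i₂ x} →
    edge n i₁ ≡ (gen (next (fixedGen x)) , x) → edge n i₂ ≡ (gen (next (next (fixedGen x))) , x) → doubled x ≡ true → Vec.lookup S i₂ ≡ not (Vec.lookup S i₁)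
  pair-exclusive {i₁} {i₂} {x} e₁ e₂ dx = exactly-one at-least-one at-most-one
    where
    F = fixedGen x
    moves : partner x ≢ x
    moves = doubled⇒partner≢ x dx
    at-most-one : ¬ (Vec.lookup S i₁ ≡ true × Vec.lookup S i₂ ≡ true)
    at-most-one (S₁ , S₂) = acyclic (x , i₁ , i₂ ∷ [] , cons i₁ S₁ J₁ (cons i₂ S₂ J₂ nil) , (i₁≢i₂ ∷ []) ∷ [] ∷ [])
      where
      J₁ : Joins n i₁ x (partner x)
      J₁ = subst (Joins n i₁ x) (act-next-fixedGen x) (joins⁺ e₁)
      J₂ : Joins n i₂ (partner x) x
      J₂ = joins-sym (subst (Joins n i₂ x) (act-next²-fixedGen x) (joins⁺ e₂))
      i₁≢i₂ : i₁ ≢ i₂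
      i₁≢i₂ refl = next≢next² F (cong proj₁ (trans (sym e₁) e₂))
    at-least-one : Vec.lookup S i₁ ≡ true ⊎ Vec.lookup S i₂ ≡ true
    at-least-one
      with j , s′ , Sj , ej , s′x≡ ← spanning-edge-at (gen (next F)) x
             (λ fixes → moves (trans (sym (act-next-fixedGen x)) fixes)) (edge-oriented e₁)
      with moving-generator {s = s′} (trans s′x≡ (act-next-fixedGen x)) moves
    ... | inj₁ refl = inj₁ (subst (λ z → Vec.lookup S z ≡ true) (edge-injective n (trans ej (sym e₁))) Sj)
    ... | inj₂ refl = inj₂ (subst (λ z → Vec.lookup S z ≡ true) (edge-injective n (trans ej (sym e₂))) Sj)

  spanning-lookup : ∀ {i s x} → edge n i ≡ (s , x) → Vec.lookup S i ≡ inTree (choiceOf S) s x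
  spanning-lookup {i} {s} {x} e with genView s
  ... | gen-a = a-edge∈spanning e
  ... | gen-bcd G rewrite inTree-gen (choiceOf S) G x with doubled x in dx
  ...   | false = loop∉spanning e fixes
    where
    fixes : act (gen G) x ≡ x
    fixes with act-bcd G x
    ... | inj₁ fixed = fixed
    ... | inj₂ moved = trans moved (¬doubled⇒partner≡ x dx)
  ...   | true with BCD-cases (fixedGen x) G
  ...     | inj₁ refl = trans (loop∉spanning e (act-fixedGen x)) (sym (self==chosen (fixedGen x) (choiceOf S (pairIndex x))))
  ...     | inj₂ (inj₁ refl) =
    sym (trans (next==chosen _ _) (choiceOf-pairIndex S e dx (oriented-partner e (act-next-fixedGen x))))
  ...     | inj₂ (inj₂ refl) = next²-case (oriented-partner e (act-next²-fixedGen x))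
    where
    next²-case : leqᵇ x (partner x) ≡ true →
      Vec.lookup S i ≡ (next (next (fixedGen x)) == chosen (fixedGen x) (choiceOf S (pairIndex x)))
    next²-case x≤px
      with i₁ , e₁ ← edgeIndex (gen (next (fixedGen x))) x (subst (λ z → leqᵇ x z ≡ true) (sym (act-next-fixedGen x)) x≤px)
      = trans (pair-exclusive e₁ e dx) (sym (trans (next²==chosen _ _) (cong not (choiceOf-pairIndex S e₁ dx x≤px))))

  spanning⇒tree : S ≡ tree k (choiceOf S)
  spanning⇒tree = trans (sym (tabulate∘lookup S)) (tabulate-cong λ i → spanning-lookup refl)

-- Counting

length-cartesianProduct : {A B : Set} (xs : List A) (ys : List B) →
  length (cartesianProduct xs ys) ≡ length xs * length ys
length-cartesianProduct []       ys = refl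
length-cartesianProduct (x ∷ xs) ys =
  trans (length-++ (map (x ,_) ys)) (cong₂ _+_ (length-map (x ,_) ys) (length-cartesianProduct xs ys))

unique⊆⇒length≤ : {A : Set} {xs ys : List A} → Unique xs → (∀ {x} → x ∈ xs → x ∈ ys) → length xs ≤ length ys
unique⊆⇒length≤ {xs = xs} {ys} xs-unique xs⊆ys = injective⇒≤ {f = indexIn-ys} injective
  where
  indexIn-ys : Fin (length xs) → Fin (length ys)
  indexIn-ys i = index (xs⊆ys (∈-lookup i))
  injective : ∀ {i j} → indexIn-ys i ≡ indexIn-ys j → i ≡ j
  injective {i} {j} e = unique⇒lookup-injective xs-unique i j (begin
    List.lookup xs i                 ≡⟨ lookup-index (xs⊆ys (∈-lookup i)) ⟩
    List.lookup ys (indexIn-ys i) ≡⟨ cong (List.lookup ys) e ⟩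
    List.lookup ys (indexIn-ys j) ≡⟨ sym (lookup-index (xs⊆ys (∈-lookup j))) ⟩
    List.lookup xs j                 ∎)
    where open ≡-Reasoning

Table : ℕ → Set
Table zero    = Bool
Table (suc k) = Table k × Table k

_!_ : {k : ℕ} → Table k → Choice k
_!_ {zero}  t       []          = t
_!_ {suc k} (t , _) (false ∷ w) = t ! w
_!_ {suc k} (_ , t) (true ∷ w)  = t ! w

tabulateᵀ : {k : ℕ} → Choice k → Table k
tabulateᵀ {zero}  χ = χ []
tabulateᵀ {suc k} χ = tabulateᵀ (χ ∘ (false ∷_)) , tabulateᵀ (χ ∘ (true ∷_))

tabulateᵀ-! : {k : ℕ} (χ : Choice k) (w : Word k) → tabulateᵀ χ ! w ≡ χ w
tabulateᵀ-! χ []          = refl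
tabulateᵀ-! χ (false ∷ w) = tabulateᵀ-! (χ ∘ (false ∷_)) w
tabulateᵀ-! χ (true ∷ w)  = tabulateᵀ-! (χ ∘ (true ∷_)) w

!-ext : {k : ℕ} (t t′ : Table k) → (∀ w → t ! w ≡ t′ ! w) → t ≡ t′
!-ext {zero}  t t′ h = h []
!-ext {suc k} (t₀ , t₁) (t₀′ , t₁′) h =
  cong₂ _,_ (!-ext t₀ t₀′ (λ w → h (false ∷ w))) (!-ext t₁ t₁′ (λ w → h (true ∷ w)))

tables : (k : ℕ) → List (Table k)
tables zero    = true ∷ false ∷ []
tables (suc k) = cartesianProduct (tables k) (tables k)

∈-tables : {k : ℕ} (t : Table k) → t ∈ tables k
∈-tables {zero}  true      = here refl
∈-tables {zero}  false     = there (here refl)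
∈-tables {suc k} (t₀ , t₁) = ∈-cartesianProduct⁺ (∈-tables t₀) (∈-tables t₁)

tables-unique : (k : ℕ) → Unique (tables k)
tables-unique zero    = ((λ ()) ∷ []) ∷ [] ∷ []
tables-unique (suc k) = cartesianProduct⁺ (tables-unique k) (tables-unique k)

length-tables : (k : ℕ) → length (tables k) ≡ 2 ^ (2 ^ k)
length-tables zero    = refl
length-tables (suc k) = begin
  length (cartesianProduct (tables k) (tables k)) ≡⟨ length-cartesianProduct (tables k) (tables k) ⟩
  length (tables k) * length (tables k)           ≡⟨ cong₂ _*_ (length-tables k) (length-tables k) ⟩
  2 ^ (2 ^ k) * 2 ^ (2 ^ k)                        ≡⟨ sym (^-distribˡ-+-* 2 (2 ^ k) (2 ^ k)) ⟩
  2 ^ (2 ^ k + 2 ^ k)                              ≡⟨ cong (λ e → 2 ^ (2 ^ k + e)) (sym (+-identityʳ (2 ^ k))) ⟩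
  2 ^ (2 ^ suc k)                                  ∎
  where open ≡-Reasoning

PartialTable : ℕ → Set
PartialTable zero    = ⊤
PartialTable (suc k) = Table k × PartialTable k

-- The value read at origin k, where a partial table stores nothing, is a dummy false.
_!⁻_ : {k : ℕ} → PartialTable k → Choice k
_!⁻_ {zero}  _       []          = false
_!⁻_ {suc k} (t , _) (false ∷ w) = t ! w
_!⁻_ {suc k} (_ , t) (true ∷ w)  = t !⁻ w

!⁻-ext : {k : ℕ} (t t′ : PartialTable k) → (∀ w → w ≢ origin k → t !⁻ w ≡ t′ !⁻ w) → t ≡ t′
!⁻-ext {zero}  _ _ _ = refl
!⁻-ext {suc k} (t₀ , t₁) (t₀′ , t₁′) h =
  cong₂ _,_ (!-ext t₀ t₀′ (λ w → h (false ∷ w) λ ())) (!⁻-ext t₁ t₁′ (λ w w≢o → h (true ∷ w) (w≢o ∘ ∷-injectiveʳ)))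

partialTables : (k : ℕ) → List (PartialTable k)
partialTables zero    = tt ∷ []
partialTables (suc k) = cartesianProduct (tables k) (partialTables k)

partialTables-unique : (k : ℕ) → Unique (partialTables k)
partialTables-unique zero    = [] ∷ []
partialTables-unique (suc k) = cartesianProduct⁺ (tables-unique k) (partialTables-unique k)

pairCount : ℕ → ℕ
pairCount zero    = 0
pairCount (suc k) = 2 ^ k + pairCount k

suc-pairCount : (k : ℕ) → suc (pairCount k) ≡ 2 ^ k
suc-pairCount zero    = refl
suc-pairCount (suc k) = begin
  suc (2 ^ k + pairCount k) ≡⟨ sym (+-suc (2 ^ k) (pairCount k)) ⟩
  2 ^ k + suc (pairCount k) ≡⟨ cong (2 ^ k +_) (suc-pairCount k) ⟩
  2 ^ k + 2 ^ k             ≡⟨ cong (2 ^ k +_) (sym (+-identityʳ (2 ^ k))) ⟩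
  2 ^ suc k                 ∎
  where open ≡-Reasoning

length-partialTables : (k : ℕ) → length (partialTables k) ≡ 2 ^ pairCount k
length-partialTables zero    = refl
length-partialTables (suc k) = begin
  length (cartesianProduct (tables k) (partialTables k)) ≡⟨ length-cartesianProduct (tables k) (partialTables k) ⟩
  length (tables k) * length (partialTables k)           ≡⟨ cong₂ _*_ (length-tables k) (length-partialTables k) ⟩
  2 ^ (2 ^ k) * 2 ^ pairCount k                           ≡⟨ sym (^-distribˡ-+-* 2 (2 ^ k) (pairCount k)) ⟩
  2 ^ (2 ^ k + pairCount k)                               ∎
  where open ≡-Reasoning

spanningTreeCount≤ : ∀ {k t} → SpanningTreeCount (suc k) t → t ≤ 2 ^ (2 ^ k)
spanningTreeCount≤ {k} (L , L-unique , refl , L⇔) = begin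
  length L                                ≤⟨ unique⊆⇒length≤ L-unique L⊆trees ⟩
  length (map (λ t → tree k (t !_)) (tables k)) ≡⟨ length-map _ (tables k) ⟩
  length (tables k)                       ≡⟨ length-tables k ⟩
  2 ^ (2 ^ k)                             ∎
  where
  open ≤-Reasoning
  L⊆trees : ∀ {S} → S ∈ L → S ∈ map (λ t → tree k (t !_)) (tables k)
  L⊆trees {S} S∈L = subst (_∈ map (λ t → tree k (t !_)) (tables k)) (sym S≡tree)
    (∈-map⁺ (λ t → tree k (t !_)) (∈-tables (tabulateᵀ (choiceOf S))))
    where
    S≡tree : S ≡ tree k (tabulateᵀ (choiceOf S) !_)
    S≡tree = trans (spanning⇒tree (Equivalence.to (L⇔ S) S∈L)) (tree-cong {k} {choiceOf S} λ y → sym (tabulateᵀ-! {k} (choiceOf S) y))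

spanningTreeCount≥ : ∀ {k t} → SpanningTreeCount (suc k) t → 2 ^ pairCount k ≤ t
spanningTreeCount≥ {k} (L , _ , refl , L⇔) = begin
  2 ^ pairCount k                                  ≡⟨ sym (length-partialTables k) ⟩
  length (partialTables k)                         ≡⟨ sym (length-map partialTree (partialTables k)) ⟩
  length (map partialTree (partialTables k))       ≤⟨ unique⊆⇒length≤ (map⁺ partialTree-injective (partialTables-unique k)) trees⊆L ⟩
  length L                                         ∎
  where
  open ≤-Reasoning
  partialTree : PartialTable k → EdgeSubset (suc k)
  partialTree t = tree k (t !⁻_)
  partialTree-injective : ∀ {t t′} → partialTree t ≡ partialTree t′ → t ≡ t′
  partialTree-injective {t} {t′} e = !⁻-ext t t′ λ y y≢o →
    trans (sym (choiceOf-tree (t !⁻_) y y≢o)) (trans (cong (λ S → choiceOf S y) e) (choiceOf-tree (t′ !⁻_) y y≢o))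
  trees⊆L : ∀ {S} → S ∈ map partialTree (partialTables k) → S ∈ L
  trees⊆L S∈ with t , _ , refl ← ∈-map⁻ partialTree S∈ = Equivalence.from (L⇔ _) (tree-spanning (t !⁻_))

^-distrib-* : ∀ x y m → (x * y) ^ m ≡ x ^ m * y ^ m
^-distrib-* x y zero    = refl
^-distrib-* x y (suc m) = trans (cong (x * y *_) (^-distrib-* x y m)) ([m*n]*[o*p]≡[m*o]*[n*p] x y (x ^ m) (y ^ m))

^-double : ∀ x m → x ^ (2 * m) ≡ (x * x) ^ m
^-double x m = trans (sym (^-*-assoc x 2 m)) (cong (λ y → (x * y) ^ m) (*-identityʳ x))

n<2^n : ∀ n → n < 2 ^ n
n<2^n zero    = s≤s z≤n
n<2^n (suc n) = ≤-trans (s≤s (n<2^n n))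
  (≤-trans (+-monoˡ-≤ (2 ^ n) (m^n>0 2 n)) (≤-reflexive (cong (2 ^ n +_) (sym (+-identityʳ (2 ^ n))))))

-- Bernoulli's inequality (1 + 1/m)^n ≥ 1 + n/m, cleared of denominators.
bernoulli : ∀ m n → m ^ n * (m + n) ≤ m * suc m ^ n
bernoulli m zero    = ≤-reflexive (trans (*-identityˡ (m + 0)) (trans (+-identityʳ m) (sym (*-identityʳ m))))
bernoulli m (suc n) = begin
  m * m ^ n * (m + suc n)                 ≡⟨ expand-left m (m ^ n) n ⟩
  m * (m ^ n * (m + n)) + m * m ^ n       ≤⟨ +-mono-≤ (*-monoʳ-≤ m (bernoulli m n)) m·mⁿ≤ ⟩
  m * (m * suc m ^ n) + m * suc m ^ n     ≡⟨ expand-right m (suc m ^ n) ⟩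
  m * (suc m * suc m ^ n)                 ∎
  where
  open ≤-Reasoning
  expand-left : ∀ m x n → m * x * (m + suc n) ≡ m * (x * (m + n)) + m * x
  expand-left = solve-∀
  expand-right : ∀ m y → m * (m * y) + m * y ≡ m * (suc m * y)
  expand-right = solve-∀
  m·mⁿ≤ : m * m ^ n ≤ m * suc m ^ n
  m·mⁿ≤ = ≤-trans (≤-reflexive (*-comm m (m ^ n))) (≤-trans (*-monoʳ-≤ (m ^ n) (m≤m+n m n)) (bernoulli m n))

2*m^n≤o^n : ∀ {m n o} → m < o → m ≤ n → 1 ≤ n → 2 * m ^ n ≤ o ^ n
2*m^n≤o^n {zero}  {suc n} _ _ _ = z≤n
2*m^n≤o^n {suc m} {n} {o} m<o m≤n _ = ≤-trans (*-cancelˡ-≤ (suc m) (begin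
  suc m * (2 * suc m ^ n)       ≡⟨ rearrange (suc m) (suc m ^ n) ⟩
  suc m ^ n * (suc m + suc m)   ≤⟨ *-monoʳ-≤ (suc m ^ n) (+-monoʳ-≤ (suc m) m≤n) ⟩
  suc m ^ n * (suc m + n)       ≤⟨ bernoulli (suc m) n ⟩
  suc m * suc (suc m) ^ n       ∎)) (^-monoˡ-≤ n m<o)
  where
  open ≤-Reasoning
  rearrange : ∀ m x → m * (2 * x) ≡ x * (m + m)
  rearrange = solve-∀

below-√2 : ∀ {p q} m → p * p < 2 * (q * q) → p * p ≤ m → 1 ≤ m → 2 * p ^ (2 * m) ≤ 2 ^ m * q ^ (2 * m)
below-√2 {p} {q} m p²<2q² p²≤m 1≤m = begin
  2 * p ^ (2 * m)       ≡⟨ cong (2 *_) (^-double p m) ⟩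
  2 * (p * p) ^ m       ≤⟨ 2*m^n≤o^n p²<2q² p²≤m 1≤m ⟩
  (2 * (q * q)) ^ m     ≡⟨ ^-distrib-* 2 (q * q) m ⟩
  2 ^ m * (q * q) ^ m   ≡⟨ cong (2 ^ m *_) (sym (^-double q m)) ⟩
  2 ^ m * q ^ (2 * m)   ∎
  where open ≤-Reasoning

above-√2 : ∀ {r s} m → 2 * (s * s) ≤ r * r → 2 ^ m * s ^ (2 * m) ≤ r ^ (2 * m)
above-√2 {r} {s} m 2s²≤r² = begin
  2 ^ m * s ^ (2 * m)   ≡⟨ cong (2 ^ m *_) (^-double s m) ⟩
  2 ^ m * (s * s) ^ m   ≡⟨ sym (^-distrib-* 2 (s * s) m) ⟩
  (2 * (s * s)) ^ m     ≤⟨ ^-monoˡ-≤ m 2s²≤r² ⟩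
  (r * r) ^ m           ≡⟨ sym (^-double r m) ⟩
  r ^ (2 * m)           ∎
  where open ≤-Reasoning

mainTheorem19 : (τ : ℕ → ℕ) → (∀ n → 1 ≤ n → SpanningTreeCount n (τ n)) →
    ∀ (p q r s : ℕ) → 0 < q → 0 < s → p * p < 2 * (q * q) → 2 * (s * s) < r * r →
    ∃[ N ] (∀ n → N ≤ n →
      p ^ (2 ^ n) ≤ τ n * q ^ (2 ^ n) × τ n * s ^ (2 ^ n) ≤ r ^ (2 ^ n))
mainTheorem19 τ count p q r s _ _ p²<2q² 2s²<r² = suc (p * p) , bounds
  where
  bounds : ∀ n → suc (p * p) ≤ n → p ^ (2 ^ n) ≤ τ n * q ^ (2 ^ n) × τ n * s ^ (2 ^ n) ≤ r ^ (2 ^ n)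
  bounds (suc k) (s≤s p²≤k) = lower , upper
    where
    open ≤-Reasoning
    m = 2 ^ k
    count-k = count (suc k) (s≤s z≤n)
    lower : p ^ (2 * m) ≤ τ (suc k) * q ^ (2 * m)
    lower = *-cancelˡ-≤ 2 (begin
      2 * p ^ (2 * m)                      ≤⟨ below-√2 m p²<2q² (≤-trans p²≤k (<⇒≤ (n<2^n k))) (m^n>0 2 k) ⟩
      2 ^ m * q ^ (2 * m)                  ≡⟨ cong (λ e → 2 ^ e * q ^ (2 * m)) (sym (suc-pairCount k)) ⟩
      2 * 2 ^ pairCount k * q ^ (2 * m)    ≡⟨ *-assoc 2 (2 ^ pairCount k) (q ^ (2 * m)) ⟩
      2 * (2 ^ pairCount k * q ^ (2 * m))  ≤⟨ *-monoʳ-≤ 2 (*-monoˡ-≤ (q ^ (2 * m)) (spanningTreeCount≥ count-k)) ⟩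
      2 * (τ (suc k) * q ^ (2 * m))        ∎)
    upper : τ (suc k) * s ^ (2 * m) ≤ r ^ (2 * m)
    upper = begin
      τ (suc k) * s ^ (2 * m)  ≤⟨ *-monoˡ-≤ (s ^ (2 * m)) (spanningTreeCount≤ count-k) ⟩
      2 ^ m * s ^ (2 * m)      ≤⟨ above-√2 m (<⇒≤ 2s²<r²) ⟩
      r ^ (2 * m)              ∎
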